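{- Let $\Gamma = GPaley(p^R, \frac{p^R-1}{k}) = Cay(V,S)$ be the generalised Paley graph with vertex set $V = \mathbb{F}_{p^R}$ and connection set $S = \langle \omega^k \rangle$. Then the following hold: 1. $\Gamma$ is connected if and only if the group $\langle \widehat{\omega}^k \rangle$ acts irreducibly on $V$ (regarded as an $R$-dimensional vector space over $\mathbb{F}_p$). 2. Suppose $\Gamma$ is not connected. Then the connected components of $\Gamma$ are isomorphic to $\Gamma_0 := GPaley(p^a, \frac{p^a-1}{k'})$ for some proper divisor $a$ of $R$, where $k' \mid (p^a-1)$ and $\frac{p^R-1}{k} = \frac{p^a-1}{k'}$. Furthermore, $Aut(\Gamma) = Aut(\Gamma_0) \ wr \ S_{p^{R-a}}$.
   Context: Let $p$ be a prime, $R \geq 1$, $V = \mathbb{F}_{p^R}$ the finite field of order $p^R$ and $V^* = V \setminus \{0\}$. Fix a primitive element $\omega$ of $V$, and let $\widehat{\omega}$ denote the scalar multiplication $x \mapsto x\omega$ on $V$; for $i \mid (p^R-1)$, $\langle \widehat{\omega}^i \rangle$ is the cyclic group generated by $x \mapsto x\omega^i$, and $\langle \omega^i \rangle$ denotes the set $\{1, \omega^i, \omega^{2i}, \ldots\} \subseteq V^*$. Let $k \geq 2$ be an integer dividing $p^R - 1$ such that if $p$ is odd then $\frac{p^R-1}{k}$ is even. The generalised Paley graph $GPaley(p^R, \frac{p^R-1}{k})$ is the Cayley graph $Cay(V,S)$ with connection set $S = \langle \omega^k \rangle = \{1, \omega^k, \omega^{2k}, \ldots, \omega^{p^R-1-k}\}$,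 i.e. the graph with vertex set $V$ in which $\{u,v\}$ is an edge if and only if $v - u \in S$. $Aut(\Gamma)$ denotes the full automorphism group, and $wr$ the wreath product. -}

module Defs where

open import Level using (0ℓ)
open import Data.Nat as ℕ using (ℕ; zero; suc)
open import Data.Fin using (Fin)
open import Data.Product using (Σ; ∃; _×_; _,_)
open import Data.Empty using (⊥)
open import Relation.Nullary using (¬_)
open import Relation.Binary.PropositionalEquality using (_≡_)
open import Relation.Binary.Construct.Closure.ReflexiveTransitive using (Star)
open import Algebra.Structures using (IsCommutativeRing)
open import Function.Bundles using (_↔_; _⇔_; Inverse)

-- Finite fields of order q (with propositional equality on the carrier).
-- A field of order p^R for a prime p is (up to isomorphism) F_{p^R}.

record FiniteField (q : ℕ) : Set₁ where
  infixl 6 _+_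
  infixl 7 _*_
  field
    Carrier : Set
    _+_ _*_ : Carrier → Carrier → Carrier
    -_      : Carrier → Carrier
    0# 1#   : Carrier
    isCommutativeRing : IsCommutativeRing _≡_ _+_ _*_ -_ 0# 1#
    0≢1     : ¬ (0# ≡ 1#)
    inverse : ∀ x → ¬ (x ≡ 0#) → ∃ λ y → x * y ≡ 1#
    enum    : Fin q ↔ Carrier

  _-_ : Carrier → Carrier → Carrier
  x - y = x + (- y)

  infixr 8 _^_
  _^_ : Carrier → ℕ → Carrier
  x ^ zero  = 1#
  x ^ suc n = x * (x ^ n)

  -- n · x  (the F_p-scalar action, by iterated addition)
  infixr 7 _·_
  _·_ : ℕ → Carrier → Carrier
  zero  · x = 0#
  suc n · x = x + (n · x)

open FiniteField public using (Carrier; 0#; 1#)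

IsPrimitive : ∀ {q} (F : FiniteField q) → Carrier F → Set
IsPrimitive F ω = ∀ x → ¬ (x ≡ 0# F) → ∃ λ i → x ≡ FiniteField._^_ F ω i

record Graph : Set₁ where
  field
    Vertex : Set
    Adj    : Vertex → Vertex → Set

open Graph public

Reachable : (Γ : Graph) → Vertex Γ → Vertex Γ → Set
Reachable Γ = Star (Adj Γ)

Connected : Graph → Set
Connected Γ = ∀ u v → Reachable Γ u v

Cay : ∀ {q} (F : FiniteField q) → (Carrier F → Set) → Graph
Cay F S = record { Vertex = Carrier F ; Adj = λ u v → S (FiniteField._-_ F v u) }

PowersOf : ∀ {q} (F : FiniteField q) → Carrier F → ℕ → Carrier F → Set
PowersOf F ω k x = ∃ λ i → x ≡ FiniteField._^_ F ω (k ℕ.* i)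

-- GPaley(q, (q-1)/k) = Cay(F, ⟨ω^k⟩)
GPaley : ∀ {q} (F : FiniteField q) (ω : Carrier F) (k : ℕ) → Graph
GPaley F ω k = Cay F (PowersOf F ω k)

record IsSubspace {q} (F : FiniteField q) (p : ℕ) (W : Carrier F → Set) : Set where
  field
    zero∈ : W (0# F)
    +-closed : ∀ {x y} → W x → W y → W (FiniteField._+_ F x y)
    ·-closed : ∀ (c : Fin p) {x} → W x → W (FiniteField._·_ F (Data.Fin.toℕ c) x)

Invariant : ∀ {q} (F : FiniteField q) (ω : Carrier F) (k : ℕ) (W : Carrier F → Set) → Set
Invariant F ω k W = ∀ i {x} → W x → W (FiniteField._*_ F x (FiniteField._^_ F ω (k ℕ.* i)))

ActsIrreducibly : ∀ {q} (F : FiniteField q) (p : ℕ) (ω : Carrier F) (k : ℕ) → Set₁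
ActsIrreducibly F p ω k =
  (W : Carrier F → Set) → IsSubspace F p W → Invariant F ω k W →
  (∃ λ x → W x × ¬ (x ≡ 0# F)) → ∀ y → W y

IsoOntoComponent : (Γ₀ Γ : Graph) → Vertex Γ → (Vertex Γ₀ → Vertex Γ) → Set
IsoOntoComponent Γ₀ Γ v f =
    (∀ x y → f x ≡ f y → x ≡ y)
  × (∀ x y → Adj Γ₀ x y ⇔ Adj Γ (f x) (f y))
  × (∀ u → Reachable Γ v u ⇔ (∃ λ x → f x ≡ u))

IsAutomorphism : (Γ : Graph) → Vertex Γ ↔ Vertex Γ → Set
IsAutomorphism Γ g = ∀ u v → Adj Γ u v ⇔ Adj Γ (Inverse.to g u) (Inverse.to g v)

-- Aut(Γ) = Aut(Γ₀) wr S_n in its imprimitive action, with respect to a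
-- labelling φ : Fin n × V(Γ₀) ≅ V(Γ) identifying the n connected
-- components of Γ with copies of Γ₀:
IsComponentLabelling : (Γ₀ Γ : Graph) (n : ℕ) → (Fin n × Vertex Γ₀) ↔ Vertex Γ → Set
IsComponentLabelling Γ₀ Γ n φ =
    (∀ j x y → Adj Γ₀ x y ⇔ Adj Γ (φ⟨ j , x ⟩) (φ⟨ j , y ⟩))
  × (∀ j x y → Reachable Γ (φ⟨ j , x ⟩) (φ⟨ j , y ⟩))
  × (∀ j j' x y → Reachable Γ (φ⟨ j , x ⟩) (φ⟨ j' , y ⟩) → j ≡ j')
  where φ⟨_⟩ = Inverse.to φ

AutIsWreath : (Γ₀ Γ : Graph) (n : ℕ) → (Fin n × Vertex Γ₀) ↔ Vertex Γ → Set
AutIsWreath Γ₀ Γ n φ =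
  (g : Vertex Γ ↔ Vertex Γ) →
    IsAutomorphism Γ g
    ⇔ (Σ (Fin n ↔ Fin n) λ σ →
       Σ (Fin n → Vertex Γ₀ ↔ Vertex Γ₀) λ h →
         (∀ j → IsAutomorphism Γ₀ (h j))
       × (∀ j x → Inverse.to g (φ⟨ j , x ⟩)
                  ≡ φ⟨ Inverse.to σ j , Inverse.to (h j) x ⟩))
  where φ⟨_⟩ = Inverse.to φ

module Submission where

-- Let K be the vertex set of the component of 0 in Γ = Cay(V, S); by translation invariance the
-- components are the cosets v + K. K is closed under addition and under multiplication by S, so
-- scaling a walk from 0 to y by x ∈ K shows that K is closed under multiplication: K is a subfield.
-- (1) An invariant F_p-subspace containing x ≠ 0 contains xK by the same walk argument, so it is V
-- when Γ is connected; conversely K itself is an invariant subspace containing 1.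
-- (2) If e is least with ω^e ∈ K then K* = ⟨ω^e⟩ and e ∣ k, and u ↦ v + u maps GPaley(K, ω^e, k/e)
-- onto the component of v. Counting cosets gives |K| = p^a with a ∣ R, and an automorphism of Γ
-- permutes the components, acting on each of them as an automorphism of the component.

open import Defs hiding (0#; 1#)
open import Level using (0ℓ)
open import Algebra.Bundles using (CommutativeRing)
open import Algebra.Morphism.Structures using (IsRingMonomorphism)
import Algebra.Morphism.RingMonomorphism as RingMonomorphism
open import Data.Bool using (Bool; true; false; T)
open import Data.Bool.Properties using (T-irrelevant)
open import Data.Empty using (⊥-elim)
open import Data.Fin as Fin using (Fin; toℕ)
open import Data.Fin.Properties
  using (cantor-schröder-bernstein; injective⇒≤; pigeonhole; any?; toℕ<n; toℕ-fromℕ<; toℕ-injective; *↔×)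
open import Data.Nat as ℕ using (ℕ; zero; suc; _∸_; _≤_; _<_; z≤n; s≤s; z<s)
import Data.Nat.Properties as ℕₚ
open import Data.Nat.DivMod using (_%_; _/_; m≡m%n+[m/n]*n; m%n<n)
open import Data.Nat.Divisibility using (_∣_; divides; m%n≡0⇒n∣m; 1∣_)
open import Data.Nat.Induction using (<-rec)
open import Data.Nat.Solver using (module +-*-Solver)
open import Data.Product using (Σ; ∃; _×_; _,_; proj₁; proj₂)
open import Data.Product.Function.NonDependent.Propositional using (_×-↔_)
open import Data.Sum using (inj₁; inj₂)
open import Data.Unit using (tt)
open import Function.Base using (_∘_)
open import Function.Bundles using (_↔_; _⇔_; Inverse; Injection; Equivalence; mk↔ₛ′; mk⇔)
open import Function.Construct.Composition using (_↔-∘_)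
open import Function.Construct.Identity using (↔-id; ⇔-id)
open import Function.Construct.Symmetry using (↔-sym; ⇔-sym)
open import Function.Properties.Equivalence using (⇔-setoid)
open import Function.Properties.Inverse using (↔⇒↣)
open import Relation.Binary.Construct.Closure.ReflexiveTransitive using (ε; _◅_; _◅◅_; gmap)
open import Relation.Binary.Definitions using (DecidableEquality; tri<; tri≈; tri>)
open import Relation.Binary.PropositionalEquality
open import Relation.Nullary using (¬_; Dec; yes; no)
open import Relation.Nullary.Decidable using (map′; _×-dec_; toWitness; fromWitness; ⌊_⌋)
open import Relation.Unary using (Pred; Decidable)

↔-injective : ∀ {A B : Set} (f : A ↔ B) {x y} → Inverse.to f x ≡ Inverse.to f y → x ≡ y
↔-injective f = Injection.injective (↔⇒↣ f)

Fin-↔⇒≡ : ∀ {m n} → Fin m ↔ Fin n → m ≡ n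
Fin-↔⇒≡ f = cantor-schröder-bernstein (↔-injective f) (↔-injective (↔-sym f))

Filtered : ∀ {A : Set} → (A → Bool) → Set
Filtered {A} b = Σ A (T ∘ b)

Filtered-≡ : ∀ {A : Set} {b : A → Bool} {x y : Filtered b} → proj₁ x ≡ proj₁ y → x ≡ y
Filtered-≡ {x = x , t} {.x , t′} refl = cong (x ,_) (T-irrelevant t t′)

filter-enumeration : ∀ n (b : Fin n → Bool) → Σ ℕ λ r → Fin r ↔ Filtered b
filter-enumeration zero b = 0 , mk↔ₛ′ (λ ()) (λ { (() , _) }) (λ { (() , _) }) (λ ())
filter-enumeration (suc n) b with filter-enumeration n (b ∘ Fin.suc) | b Fin.zero in b₀
... | r , f | true = suc r , mk↔ₛ′ to from to∘from from∘to
  where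
  to : Fin (suc r) → Filtered b
  to Fin.zero = Fin.zero , subst T (sym b₀) tt
  to (Fin.suc j) = Fin.suc (proj₁ (Inverse.to f j)) , proj₂ (Inverse.to f j)
  from : Filtered b → Fin (suc r)
  from (Fin.zero , _) = Fin.zero
  from (Fin.suc i , t) = Fin.suc (Inverse.from f (i , t))
  to∘from : ∀ y → to (from y) ≡ y
  to∘from (Fin.zero , _) = Filtered-≡ refl
  to∘from (Fin.suc i , t) = Filtered-≡ (cong (Fin.suc ∘ proj₁) (Inverse.strictlyInverseˡ f (i , t)))
  from∘to : ∀ j → from (to j) ≡ j
  from∘to Fin.zero = refl
  from∘to (Fin.suc j) = cong Fin.suc (Inverse.strictlyInverseʳ f j)
... | r , f | false = r , mk↔ₛ′ to from to∘from (Inverse.strictlyInverseʳ f)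
  where
  to : Fin r → Filtered b
  to j = Fin.suc (proj₁ (Inverse.to f j)) , proj₂ (Inverse.to f j)
  from : Filtered b → Fin r
  from (Fin.zero , t) = ⊥-elim (subst T b₀ t)
  from (Fin.suc i , t) = Inverse.from f (i , t)
  to∘from : ∀ y → to (from y) ≡ y
  to∘from (Fin.zero , t) = ⊥-elim (subst T b₀ t)
  to∘from (Fin.suc i , t) = Filtered-≡ (cong (Fin.suc ∘ proj₁) (Inverse.strictlyInverseˡ f (i , t)))

least-Fin : ∀ {n} {P : Pred (Fin n) 0ℓ} → Decidable P → ∃ P →
            ∃ λ i → P i × (∀ j → P j → toℕ i ≤ toℕ j)
least-Fin {suc n} {P} P? w with P? Fin.zero | w
... | yes P₀ | _ = Fin.zero , P₀ , λ _ _ → z≤n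
... | no ¬P₀ | Fin.zero , P₀ = ⊥-elim (¬P₀ P₀)
... | no ¬P₀ | Fin.suc i , Pi with least-Fin (P? ∘ Fin.suc) (i , Pi)
...   | j , Pj , minimal = Fin.suc j , Pj , bound
  where
  bound : ∀ l → P l → toℕ (Fin.suc j) ≤ toℕ l
  bound Fin.zero P₀ = ⊥-elim (¬P₀ P₀)
  bound (Fin.suc l) Pl = s≤s (minimal l Pl)

least-ℕ : ∀ {P : Pred ℕ 0ℓ} → Decidable P → ∀ n → P n → ∃ λ m → P m × (∀ j → j < m → ¬ P j)
least-ℕ {P} P? = <-rec (λ n → P n → ∃ λ m → P m × (∀ j → j < m → ¬ P j)) step
  where
  step : ∀ n → (∀ {j} → j < n → P j → ∃ λ m → P m × (∀ i → i < m → ¬ P i)) →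
         P n → ∃ λ m → P m × (∀ i → i < m → ¬ P i)
  step n smaller Pn with ℕₚ.anyUpTo? P? n
  ... | yes (j , j<n , Pj) = smaller j<n Pj
  ... | no none-below = n , Pn , λ j j<n Pj → none-below (j , j<n , Pj)

-- Graphs whose components are labelled copies of one graph

Adj-cong : (Γ : Graph) {u u′ v v′ : Vertex Γ} → u ≡ u′ → v ≡ v′ → Adj Γ u v ⇔ Adj Γ u′ v′
Adj-cong Γ refl refl = ⇔-id _

automorphism⁻¹-adj : (Γ : Graph) (g : Vertex Γ ↔ Vertex Γ) → IsAutomorphism Γ g →
                     ∀ {u v} → Adj Γ u v → Adj Γ (Inverse.from g u) (Inverse.from g v)
automorphism⁻¹-adj Γ g g-aut {u} {v} a =
  Equivalence.from (g-aut _ _) (Equivalence.from (Adj-cong Γ (strictlyInverseˡ u) (strictlyInverseˡ v)) a)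
  where open Inverse g

module ComponentLabelling {Γ₀ Γ : Graph} {n : ℕ} (φ : (Fin n × Vertex Γ₀) ↔ Vertex Γ)
                          (labelling : IsComponentLabelling Γ₀ Γ n φ) (x₀ : Vertex Γ₀) where

  open Inverse φ using ()
    renaming (to to φ⟨_⟩; from to φ⁻¹; strictlyInverseˡ to φ∘φ⁻¹; strictlyInverseʳ to φ⁻¹∘φ)

  private
    adj-in-copy : ∀ j x y → Adj Γ₀ x y ⇔ Adj Γ φ⟨ j , x ⟩ φ⟨ j , y ⟩
    adj-in-copy = proj₁ labelling
    copy-connected : ∀ j x y → Reachable Γ φ⟨ j , x ⟩ φ⟨ j , y ⟩
    copy-connected = proj₁ (proj₂ labelling)
    copies-disconnected : ∀ j j′ x y → Reachable Γ φ⟨ j , x ⟩ φ⟨ j′ , y ⟩ → j ≡ j′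
    copies-disconnected = proj₂ (proj₂ labelling)

  copy : Vertex Γ → Fin n
  copy u = proj₁ (φ⁻¹ u)

  copy-φ : ∀ j x → copy φ⟨ j , x ⟩ ≡ j
  copy-φ j x = cong proj₁ (φ⁻¹∘φ (j , x))

  reachable⇒same-copy : ∀ {u v} → Reachable Γ u v → copy u ≡ copy v
  reachable⇒same-copy {u} {v} r =
    copies-disconnected _ _ _ _ (subst₂ (Reachable Γ) (sym (φ∘φ⁻¹ u)) (sym (φ∘φ⁻¹ v)) r)

  module CopyAction (G : Vertex Γ → Vertex Γ) (G-adj : ∀ {u v} → Adj Γ u v → Adj Γ (G u) (G v)) where

    σ : Fin n → Fin n
    σ j = copy (G φ⟨ j , x₀ ⟩)

    h : Fin n → Vertex Γ₀ → Vertex Γ₀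
    h j x = proj₂ (φ⁻¹ (G φ⟨ j , x ⟩))

    copy-G : ∀ j x → copy (G φ⟨ j , x ⟩) ≡ σ j
    copy-G j x = sym (reachable⇒same-copy (gmap G G-adj (copy-connected j x₀ x)))

    G-φ : ∀ j x → G φ⟨ j , x ⟩ ≡ φ⟨ σ j , h j x ⟩
    G-φ j x = trans (sym (φ∘φ⁻¹ _)) (cong (λ i → φ⟨ i , h j x ⟩) (copy-G j x))

  module _ (G G⁻ : Vertex Γ → Vertex Γ)
           (G-adj : ∀ {u v} → Adj Γ u v → Adj Γ (G u) (G v))
           (G⁻-adj : ∀ {u v} → Adj Γ u v → Adj Γ (G⁻ u) (G⁻ v))
           (G⁻∘G : ∀ u → G⁻ (G u) ≡ u) where

    private
      module A = CopyAction G G-adj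
      module B = CopyAction G⁻ G⁻-adj

    σ-inverse : ∀ j → B.σ (A.σ j) ≡ j
    σ-inverse j = begin
      B.σ (A.σ j)                      ≡⟨ sym (B.copy-G (A.σ j) (A.h j x₀)) ⟩
      copy (G⁻ φ⟨ A.σ j , A.h j x₀ ⟩) ≡⟨ cong (copy ∘ G⁻) (sym (A.G-φ j x₀)) ⟩
      copy (G⁻ (G φ⟨ j , x₀ ⟩))        ≡⟨ cong copy (G⁻∘G _) ⟩
      copy φ⟨ j , x₀ ⟩                 ≡⟨ copy-φ j x₀ ⟩
      j                                ∎
      where open ≡-Reasoning

    h-inverse : ∀ j x → B.h (A.σ j) (A.h j x) ≡ x
    h-inverse j x = begin
      proj₂ (φ⁻¹ (G⁻ φ⟨ A.σ j , A.h j x ⟩)) ≡⟨ cong (proj₂ ∘ φ⁻¹ ∘ G⁻) (sym (A.G-φ j x)) ⟩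
      proj₂ (φ⁻¹ (G⁻ (G φ⟨ j , x ⟩)))       ≡⟨ cong (proj₂ ∘ φ⁻¹) (G⁻∘G _) ⟩
      proj₂ (φ⁻¹ φ⟨ j , x ⟩)                ≡⟨ cong proj₂ (φ⁻¹∘φ (j , x)) ⟩
      x                                     ∎
      where open ≡-Reasoning

  WreathElement : Vertex Γ ↔ Vertex Γ → Set
  WreathElement g =
    Σ (Fin n ↔ Fin n) λ σ → Σ (Fin n → Vertex Γ₀ ↔ Vertex Γ₀) λ h →
      (∀ j → IsAutomorphism Γ₀ (h j))
    × (∀ j x → Inverse.to g φ⟨ j , x ⟩ ≡ φ⟨ Inverse.to σ j , Inverse.to (h j) x ⟩)

  automorphism⇒wreath : (g : Vertex Γ ↔ Vertex Γ) → IsAutomorphism Γ g → WreathElement g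
  automorphism⇒wreath g g-aut = σ , h , h-automorphism , A.G-φ
    where
    open Inverse g using (to; from; strictlyInverseˡ; strictlyInverseʳ)
    to-adj : ∀ {u v} → Adj Γ u v → Adj Γ (to u) (to v)
    to-adj = Equivalence.to (g-aut _ _)
    from-adj : ∀ {u v} → Adj Γ u v → Adj Γ (from u) (from v)
    from-adj = automorphism⁻¹-adj Γ g g-aut
    module A = CopyAction to to-adj
    module B = CopyAction from from-adj
    σ : Fin n ↔ Fin n
    σ = mk↔ₛ′ A.σ B.σ (σ-inverse from to from-adj to-adj strictlyInverseˡ)
                      (σ-inverse to from to-adj from-adj strictlyInverseʳ)
    h : Fin n → Vertex Γ₀ ↔ Vertex Γ₀
    h j = mk↔ₛ′ (A.h j) (B.h (A.σ j)) right (h-inverse to from to-adj from-adj strictlyInverseʳ j)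
      where
      right : ∀ y → A.h j (B.h (A.σ j) y) ≡ y
      right y = trans (cong (λ i → A.h i (B.h (A.σ j) y))
                            (sym (σ-inverse to from to-adj from-adj strictlyInverseʳ j)))
                      (h-inverse from to from-adj to-adj strictlyInverseˡ (A.σ j) y)
    h-automorphism : ∀ j → IsAutomorphism Γ₀ (h j)
    h-automorphism j x y = begin
      Adj Γ₀ x y                                      ≈⟨ adj-in-copy j x y ⟩
      Adj Γ φ⟨ j , x ⟩ φ⟨ j , y ⟩                     ≈⟨ g-aut _ _ ⟩
      Adj Γ (to φ⟨ j , x ⟩) (to φ⟨ j , y ⟩)           ≈⟨ Adj-cong Γ (A.G-φ j x) (A.G-φ j y) ⟩
      Adj Γ φ⟨ A.σ j , A.h j x ⟩ φ⟨ A.σ j , A.h j y ⟩ ≈⟨ ⇔-sym (adj-in-copy (A.σ j) _ _) ⟩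
      Adj Γ₀ (A.h j x) (A.h j y)                      ∎
      where open import Relation.Binary.Reasoning.Setoid (⇔-setoid 0ℓ)

  wreath⇒automorphism : (g : Vertex Γ ↔ Vertex Γ) → WreathElement g → IsAutomorphism Γ g
  wreath⇒automorphism g (σ , h , h-aut , g-φ) u v =
    subst₂ (λ u v → Adj Γ u v ⇔ Adj Γ (Inverse.to g u) (Inverse.to g v)) (φ∘φ⁻¹ u) (φ∘φ⁻¹ v)
      (across (proj₁ (φ⁻¹ u)) (proj₂ (φ⁻¹ u)) (proj₁ (φ⁻¹ v)) (proj₂ (φ⁻¹ v)))
    where
    open Inverse g using (to)
    within : ∀ j x y → Adj Γ φ⟨ j , x ⟩ φ⟨ j , y ⟩ ⇔ Adj Γ (to φ⟨ j , x ⟩) (to φ⟨ j , y ⟩)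
    within j x y = begin
      Adj Γ φ⟨ j , x ⟩ φ⟨ j , y ⟩                  ≈⟨ ⇔-sym (adj-in-copy j x y) ⟩
      Adj Γ₀ x y                                   ≈⟨ h-aut j x y ⟩
      Adj Γ₀ (Inverse.to (h j) x) (Inverse.to (h j) y) ≈⟨ adj-in-copy (Inverse.to σ j) _ _ ⟩
      Adj Γ φ⟨ Inverse.to σ j , Inverse.to (h j) x ⟩ φ⟨ Inverse.to σ j , Inverse.to (h j) y ⟩
                                                   ≈⟨ Adj-cong Γ (sym (g-φ j x)) (sym (g-φ j y)) ⟩
      Adj Γ (to φ⟨ j , x ⟩) (to φ⟨ j , y ⟩)        ∎
      where open import Relation.Binary.Reasoning.Setoid (⇔-setoid 0ℓ)
    same-copy : ∀ {j x j′ y} → j ≡ j′ →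
                Adj Γ φ⟨ j , x ⟩ φ⟨ j′ , y ⟩ ⇔ Adj Γ (to φ⟨ j , x ⟩) (to φ⟨ j′ , y ⟩)
    same-copy {j} {x} {_} {y} refl = within j x y
    across : ∀ j x j′ y →
             Adj Γ φ⟨ j , x ⟩ φ⟨ j′ , y ⟩ ⇔ Adj Γ (to φ⟨ j , x ⟩) (to φ⟨ j′ , y ⟩)
    across j x j′ y = mk⇔
      (λ a → Equivalence.to (same-copy (copies-disconnected _ _ _ _ (a ◅ ε))) a)
      (λ a → Equivalence.from (same-copy (↔-injective σ (copies-disconnected _ _ _ _
                 (subst₂ (Reachable Γ) (g-φ j x) (g-φ j′ y) (a ◅ ε))))) a)

  automorphism-is-wreath : AutIsWreath Γ₀ Γ n φ
  automorphism-is-wreath g = mk⇔ (automorphism⇒wreath g) (wreath⇒automorphism g)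

module FieldProperties {q : ℕ} (F : FiniteField q) where

  open FiniteField F public renaming (Carrier to V)

  commutativeRing : CommutativeRing 0ℓ 0ℓ
  commutativeRing = record { isCommutativeRing = isCommutativeRing }

  open CommutativeRing commutativeRing public
    using (+-assoc; +-comm; +-identityˡ; +-identityʳ; -‿inverseˡ; -‿inverseʳ;
           *-assoc; *-comm; *-identityˡ; *-identityʳ; distribˡ; distribʳ; zeroˡ; zeroʳ)
  open import Algebra.Properties.AbelianGroup (CommutativeRing.+-abelianGroup commutativeRing) public
    using (inverseʳ-unique)
    renaming (∙-cancelˡ to +-cancelˡ; ⁻¹-involutive to -‿involutive;
              ⁻¹-anti-homo‿- to -[x-y]≡y-x; ε⁻¹≈ε to -0≡0)
  open import Algebra.Properties.Ring (CommutativeRing.ring commutativeRing) public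
    using ([y-z]x≈yx-zx)

  infix 4 _≟_
  _≟_ : DecidableEquality V
  x ≟ y = map′ (↔-injective (↔-sym enum)) (cong (Inverse.from enum))
               (Inverse.from enum x Fin.≟ Inverse.from enum y)

  x+[y-x]≡y : ∀ x y → x + (y - x) ≡ y
  x+[y-x]≡y x y = begin
    x + (y - x)   ≡⟨ cong (x +_) (+-comm y (- x)) ⟩
    x + (- x + y) ≡⟨ sym (+-assoc x (- x) y) ⟩
    (x - x) + y   ≡⟨ cong (_+ y) (-‿inverseʳ x) ⟩
    0# + y        ≡⟨ +-identityˡ y ⟩
    y             ∎
    where open ≡-Reasoning

  [x+y]-x≡y : ∀ x y → (x + y) - x ≡ y
  [x+y]-x≡y x y = +-cancelˡ x _ _ (x+[y-x]≡y x (x + y))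

  [x+y]-[x+z]≡y-z : ∀ x y z → (x + y) - (x + z) ≡ y - z
  [x+y]-[x+z]≡y-z x y z = +-cancelˡ (x + z) _ _ (begin
    (x + z) + ((x + y) - (x + z)) ≡⟨ x+[y-x]≡y (x + z) (x + y) ⟩
    x + y                         ≡⟨ cong (x +_) (sym (x+[y-x]≡y z y)) ⟩
    x + (z + (y - z))             ≡⟨ sym (+-assoc x z (y - z)) ⟩
    (x + z) + (y - z)             ∎)
    where open ≡-Reasoning

  [y-x]+[z-y]≡z-x : ∀ x y z → (y - x) + (z - y) ≡ z - x
  [y-x]+[z-y]≡z-x x y z = +-cancelˡ x _ _ (begin
    x + ((y - x) + (z - y)) ≡⟨ sym (+-assoc x (y - x) (z - y)) ⟩
    (x + (y - x)) + (z - y) ≡⟨ cong (_+ (z - y)) (x+[y-x]≡y x y) ⟩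
    y + (z - y)             ≡⟨ x+[y-x]≡y y z ⟩
    z                       ≡⟨ sym (x+[y-x]≡y x z) ⟩
    x + (z - x)             ∎)
    where open ≡-Reasoning

  x-0≡x : ∀ x → x - 0# ≡ x
  x-0≡x x = trans (cong (x +_) -0≡0) (+-identityʳ x)

  ^-+ : ∀ x m n → x ^ (m ℕ.+ n) ≡ x ^ m * x ^ n
  ^-+ x zero n = sym (*-identityˡ _)
  ^-+ x (suc m) n = trans (cong (x *_) (^-+ x m n)) (sym (*-assoc x (x ^ m) (x ^ n)))

  1^n≡1 : ∀ n → 1# ^ n ≡ 1#
  1^n≡1 zero = refl
  1^n≡1 (suc n) = trans (*-identityˡ _) (1^n≡1 n)

  ^-* : ∀ x m n → x ^ (m ℕ.* n) ≡ (x ^ m) ^ n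
  ^-* x m zero = cong (x ^_) (ℕₚ.*-zeroʳ m)
  ^-* x m (suc n) = begin
    x ^ (m ℕ.* suc n)     ≡⟨ cong (x ^_) (ℕₚ.*-suc m n) ⟩
    x ^ (m ℕ.+ m ℕ.* n)   ≡⟨ ^-+ x m (m ℕ.* n) ⟩
    x ^ m * x ^ (m ℕ.* n) ≡⟨ cong (x ^ m *_) (^-* x m n) ⟩
    x ^ m * (x ^ m) ^ n   ∎
    where open ≡-Reasoning

  ·-+ : ∀ m n x → (m ℕ.+ n) · x ≡ m · x + n · x
  ·-+ zero n x = sym (+-identityˡ _)
  ·-+ (suc m) n x = trans (cong (x +_) (·-+ m n x)) (sym (+-assoc x (m · x) (n · x)))

  n·x≡[n·1]*x : ∀ n x → n · x ≡ (n · 1#) * x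
  n·x≡[n·1]*x zero x = sym (zeroˡ x)
  n·x≡[n·1]*x (suc n) x = begin
    x + n · x               ≡⟨ cong₂ _+_ (sym (*-identityˡ x)) (n·x≡[n·1]*x n x) ⟩
    1# * x + (n · 1#) * x   ≡⟨ sym (distribʳ x 1# (n · 1#)) ⟩
    (1# + n · 1#) * x       ∎
    where open ≡-Reasoning

  *-cancelˡ : ∀ x {y z} → ¬ (x ≡ 0#) → x * y ≡ x * z → y ≡ z
  *-cancelˡ x {y} {z} x≢0 xy≡xz with inverse x x≢0
  ... | x⁻¹ , xx⁻¹≡1 = begin
    y              ≡⟨ sym (*-identityˡ y) ⟩
    1# * y         ≡⟨ cong (_* y) (trans (sym xx⁻¹≡1) (*-comm x x⁻¹)) ⟩
    (x⁻¹ * x) * y  ≡⟨ *-assoc x⁻¹ x y ⟩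
    x⁻¹ * (x * y)  ≡⟨ cong (x⁻¹ *_) xy≡xz ⟩
    x⁻¹ * (x * z)  ≡⟨ sym (*-assoc x⁻¹ x z) ⟩
    (x⁻¹ * x) * z  ≡⟨ cong (_* z) (trans (*-comm x⁻¹ x) xx⁻¹≡1) ⟩
    1# * z         ≡⟨ *-identityˡ z ⟩
    z              ∎
    where open ≡-Reasoning

  x^n≢0 : ∀ {x} n → ¬ (x ≡ 0#) → ¬ (x ^ n ≡ 0#)
  x^n≢0 zero x≢0 1≡0 = 0≢1 (sym 1≡0)
  x^n≢0 {x} (suc n) x≢0 xx^n≡0 = x^n≢0 n x≢0 (*-cancelˡ x x≢0 (trans xx^n≡0 (sym (zeroʳ x))))

  x^i≡x^j⇒x^[j∸i]≡1 : ∀ {x i j} → ¬ (x ≡ 0#) → i ≤ j → x ^ i ≡ x ^ j → x ^ (j ℕ.∸ i) ≡ 1#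
  x^i≡x^j⇒x^[j∸i]≡1 {x} {i} {j} x≢0 i≤j x^i≡x^j = *-cancelˡ (x ^ i) (x^n≢0 i x≢0) (begin
    x ^ i * x ^ (j ℕ.∸ i)     ≡⟨ sym (^-+ x i (j ℕ.∸ i)) ⟩
    x ^ (i ℕ.+ (j ℕ.∸ i))     ≡⟨ cong (x ^_) (ℕₚ.m+[n∸m]≡n i≤j) ⟩
    x ^ j                     ≡⟨ sym x^i≡x^j ⟩
    x ^ i                     ≡⟨ sym (*-identityʳ _) ⟩
    x ^ i * 1#                ∎)
    where open ≡-Reasoning

  -- Opaque (here and below): unfolding these searches during type checking is prohibitively slow.
  opaque
    order : ∀ {x} → ¬ (x ≡ 0#) →
            ∃ λ N₁ → x ^ suc N₁ ≡ 1# × (∀ j → 0 < j → j < suc N₁ → ¬ (x ^ j ≡ 1#))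
    order {x} x≢0 with pigeonhole (ℕₚ.n<1+n q) (λ (i : Fin (suc q)) → Inverse.from enum (x ^ toℕ i))
    ... | i , j , i<j , x^i≡x^j
        with least-ℕ (λ t → (0 ℕ.<? t) ×-dec (x ^ t ≟ 1#)) (toℕ j ℕ.∸ toℕ i)
                     (ℕₚ.m<n⇒0<n∸m i<j ,
                      x^i≡x^j⇒x^[j∸i]≡1 x≢0 (ℕₚ.<⇒≤ i<j) (↔-injective (↔-sym enum) x^i≡x^j))
    ...   | zero , (() , _) , _
    ...   | suc N₁ , (_ , x^N≡1) , below = N₁ , x^N≡1 , λ t 0<t t<N x^t≡1 → below t t<N (0<t , x^t≡1)

  -- Two of the q + 1 values i · 1 (i ≤ q) coincide, and their difference kills 1.
  characteristic : ∃ λ c → suc c · 1# ≡ 0#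
  characteristic with pigeonhole (ℕₚ.n<1+n q) (λ (i : Fin (suc q)) → Inverse.from enum (toℕ i · 1#))
  ... | i , j , i<j , e with toℕ j ℕ.∸ toℕ i in d≡ | ℕₚ.m<n⇒0<n∸m i<j
  ...   | zero | ()
  ...   | suc c | _ = c , +-cancelˡ (toℕ i · 1#) _ _ (begin
    toℕ i · 1# + suc c · 1#        ≡⟨ sym (·-+ (toℕ i) (suc c) 1#) ⟩
    (toℕ i ℕ.+ suc c) · 1#         ≡⟨ cong (λ t → (toℕ i ℕ.+ t) · 1#) (sym d≡) ⟩
    (toℕ i ℕ.+ (toℕ j ℕ.∸ toℕ i)) · 1# ≡⟨ cong (_· 1#) (ℕₚ.m+[n∸m]≡n (ℕₚ.<⇒≤ i<j)) ⟩
    toℕ j · 1#                     ≡⟨ sym (↔-injective (↔-sym enum) e) ⟩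
    toℕ i · 1#                     ≡⟨ sym (+-identityʳ _) ⟩
    toℕ i · 1# + 0#                ∎)
    where open ≡-Reasoning

  [1+c]·x≡0 : ∀ x → suc (proj₁ characteristic) · x ≡ 0#
  [1+c]·x≡0 x = begin
    suc c · x         ≡⟨ n·x≡[n·1]*x (suc c) x ⟩
    (suc c · 1#) * x  ≡⟨ cong (_* x) (proj₂ characteristic) ⟩
    0# * x            ≡⟨ zeroˡ x ⟩
    0#                ∎
    where
    open ≡-Reasoning
    c : ℕ
    c = proj₁ characteristic

  -x≡c·x : ∀ x → - x ≡ proj₁ characteristic · x
  -x≡c·x x = sym (inverseʳ-unique x _ ([1+c]·x≡0 x))

-- The component of 0 in a generalised Paley graph

module Paley {q : ℕ} (F : FiniteField q) (ω : Carrier F) (k : ℕ) where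

  open FieldProperties F

  Γ : Graph
  Γ = GPaley F ω k

  gen : ℕ → V
  gen i = ω ^ (k ℕ.* i)

  -- turns out to be a subfield: the F_{p^a} of the statement
  K : V → Set
  K = Reachable Γ 0#

  translate : ∀ c {u v} → Reachable Γ u v → Reachable Γ (c + u) (c + v)
  translate c = gmap (c +_) λ { {u} {v} (i , v-u≡gen) → i , trans ([x+y]-[x+z]≡y-z c v u) v-u≡gen }

  scale : ∀ i {u v} → Reachable Γ u v → Reachable Γ (u * gen i) (v * gen i)
  scale i = gmap (_* gen i) λ { {u} {v} (j , v-u≡gen) → j ℕ.+ i , (begin
    (v * gen i) - (u * gen i)            ≡⟨ sym ([y-z]x≈yx-zx (gen i) v u) ⟩
    (v - u) * gen i                      ≡⟨ cong (_* gen i) v-u≡gen ⟩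
    gen j * gen i                        ≡⟨ sym (^-+ ω (k ℕ.* j) (k ℕ.* i)) ⟩
    ω ^ (k ℕ.* j ℕ.+ k ℕ.* i)            ≡⟨ cong (ω ^_) (sym (ℕₚ.*-distribˡ-+ k j i)) ⟩
    gen (j ℕ.+ i)                        ∎) }
    where open ≡-Reasoning

  reachable⇒K : ∀ {u v} → Reachable Γ u v → K (v - u)
  reachable⇒K {u} {v} r = subst₂ (Reachable Γ) (-‿inverseˡ u) (+-comm (- u) v) (translate (- u) r)

  K⇒reachable : ∀ {u v} → K (v - u) → Reachable Γ u v
  K⇒reachable {u} {v} r = subst₂ (Reachable Γ) (+-identityʳ u) (x+[y-x]≡y u v) (translate u r)

  K-+ : ∀ {x y} → K x → K y → K (x + y)
  K-+ {x} {y} Kx Ky = Kx ◅◅ subst (λ z → Reachable Γ z (x + y)) (+-identityʳ x) (translate x Ky)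

  K-gen : ∀ i → K (gen i)
  K-gen i = (i , x-0≡x (gen i)) ◅ ε

  K-1 : K 1#
  K-1 = subst K (cong (ω ^_) (ℕₚ.*-zeroʳ k)) (K-gen 0)

  K-· : ∀ n {x} → K x → K (n · x)
  K-· zero Kx = ε
  K-· (suc n) Kx = K-+ Kx (K-· n Kx)

  K-neg : ∀ {x} → K x → K (- x)
  K-neg {x} Kx = subst K (sym (-x≡c·x x)) (K-· (proj₁ characteristic) Kx)

  K-- : ∀ {x y} → K x → K y → K (x - y)
  K-- Kx Ky = K-+ Kx (K-neg Ky)

  K-*gen : ∀ i {x} → K x → K (x * gen i)
  K-*gen i {x} Kx = subst (λ z → Reachable Γ z (x * gen i)) (zeroˡ (gen i)) (scale i Kx)

  scaled-walk : (W : V → Set) → (∀ {a b} → W a → W b → W (a + b)) →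
                ∀ x → (∀ i → W (x * gen i)) → ∀ {u v} → Reachable Γ u v → W (x * u) → W (x * v)
  scaled-walk W W-+ x W-xgen ε Wxu = Wxu
  scaled-walk W W-+ x W-xgen {u} (_◅_ {j = w} (i , w-u≡gen) r) Wxu =
    scaled-walk W W-+ x W-xgen r (subst W step (W-+ Wxu (W-xgen i)))
    where
    step : x * u + x * gen i ≡ x * w
    step = begin
      x * u + x * gen i    ≡⟨ cong (λ z → x * u + x * z) (sym w-u≡gen) ⟩
      x * u + x * (w - u)  ≡⟨ sym (distribˡ x u (w - u)) ⟩
      x * (u + (w - u))    ≡⟨ cong (x *_) (x+[y-x]≡y u w) ⟩
      x * w                ∎
      where open ≡-Reasoning

  K-* : ∀ {x y} → K x → K y → K (x * y)
  K-* {x} Kx Ky = scaled-walk K K-+ x (λ i → K-*gen i Kx) Ky (subst K (sym (zeroʳ x)) ε)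

  K-^ : ∀ n {x} → K x → K (x ^ n)
  K-^ zero Kx = K-1
  K-^ (suc n) Kx = K-* Kx (K-^ n Kx)

  connected⇒irreducible : ∀ p → Connected Γ → ActsIrreducibly F p ω k
  connected⇒irreducible p connected W W-subspace W-invariant (x , Wx , x≢0) y =
    subst W x[x⁻¹y]≡y (scaled-walk W +-closed x (λ i → W-invariant i Wx) (connected 0# (x⁻¹ * y))
                                   (subst W (sym (zeroʳ x)) zero∈))
    where
    open IsSubspace W-subspace
    x⁻¹ : V
    x⁻¹ = proj₁ (inverse x x≢0)
    x[x⁻¹y]≡y : x * (x⁻¹ * y) ≡ y
    x[x⁻¹y]≡y = begin
      x * (x⁻¹ * y) ≡⟨ sym (*-assoc x x⁻¹ y) ⟩
      (x * x⁻¹) * y ≡⟨ cong (_* y) (proj₂ (inverse x x≢0)) ⟩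
      1# * y        ≡⟨ *-identityˡ y ⟩
      y             ∎
      where open ≡-Reasoning

  irreducible⇒connected : ∀ p → ActsIrreducibly F p ω k → Connected Γ
  irreducible⇒connected p irreducible u v =
    K⇒reachable (irreducible K K-subspace (λ i → K-*gen i) (1# , K-1 , λ 1≡0 → 0≢1 (sym 1≡0)) (v - u))
    where
    K-subspace : IsSubspace F p K
    K-subspace = record { zero∈ = ε ; +-closed = K-+ ; ·-closed = λ c → K-· (toℕ c) }

  connected⇔irreducible : ∀ p → Connected Γ ⇔ ActsIrreducibly F p ω k
  connected⇔irreducible p = mk⇔ (connected⇒irreducible p) (irreducible⇒connected p)

-- Primitive elements: the subfield K and its cosets

-- If ω were 0 every nonzero element would be ω⁰ = 1, so F would have at most two elements.
primitive⇒≢0 : ∀ {q} (F : FiniteField q) {ω} → IsPrimitive F ω → 3 ≤ q → ¬ (ω ≡ FiniteField.0# F)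
primitive⇒≢0 {q} F {ω} ω-primitive 3≤q ω≡0 =
  ℕₚ.<⇒≱ 3≤q (injective⇒≤ {f = zero? ∘ Inverse.to enum} (↔-injective enum ∘ zero?-injective _ _))
  where
  open FieldProperties F
  nonzero⇒≡1 : ∀ x → ¬ (x ≡ 0#) → x ≡ 1#
  nonzero⇒≡1 x x≢0 with ω-primitive x x≢0
  ... | zero , x≡1 = x≡1
  ... | suc i , x≡ω*ω^i = ⊥-elim (x≢0 (trans x≡ω*ω^i (trans (cong (_* (ω ^ i)) ω≡0) (zeroˡ _))))
  zero? : V → Fin 2
  zero? x with x ≟ 0#
  ... | yes _ = Fin.zero
  ... | no _ = Fin.suc Fin.zero
  zero?-injective : ∀ x y → zero? x ≡ zero? y → x ≡ y
  zero?-injective x y eq with x ≟ 0# | y ≟ 0#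
  zero?-injective x y eq  | yes x≡0 | yes y≡0 = trans x≡0 (sym y≡0)
  zero?-injective x y ()  | yes _   | no _
  zero?-injective x y ()  | no _    | yes _
  zero?-injective x y eq  | no x≢0  | no y≢0 = trans (nonzero⇒≡1 x x≢0) (sym (nonzero⇒≡1 y y≢0))

module PrimitivePaley {q : ℕ} (F : FiniteField q) (ω : Carrier F) (ω-primitive : IsPrimitive F ω)
                      (ω≢0 : ¬ (ω ≡ FiniteField.0# F)) (k : ℕ) where

  open FieldProperties F
  open Paley F ω k

  N₁ : ℕ
  N₁ = proj₁ (order ω≢0)

  N : ℕ
  N = suc N₁

  ω^N≡1 : ω ^ N ≡ 1#
  ω^N≡1 = proj₁ (proj₂ (order ω≢0))

  ω^-periodic : ∀ i t → ω ^ (i ℕ.+ N ℕ.* t) ≡ ω ^ i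
  ω^-periodic i t = begin
    ω ^ (i ℕ.+ N ℕ.* t)       ≡⟨ ^-+ ω i (N ℕ.* t) ⟩
    ω ^ i * ω ^ (N ℕ.* t)     ≡⟨ cong (ω ^ i *_) (^-* ω N t) ⟩
    ω ^ i * (ω ^ N) ^ t       ≡⟨ cong (λ x → ω ^ i * x ^ t) ω^N≡1 ⟩
    ω ^ i * 1# ^ t            ≡⟨ cong (ω ^ i *_) (1^n≡1 t) ⟩
    ω ^ i * 1#                ≡⟨ *-identityʳ _ ⟩
    ω ^ i                     ∎
    where open ≡-Reasoning

  ω^i≡ω^[i%N] : ∀ i → ω ^ i ≡ ω ^ (i % N)
  ω^i≡ω^[i%N] i = begin
    ω ^ i                         ≡⟨ cong (ω ^_) (m≡m%n+[m/n]*n i N) ⟩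
    ω ^ (i % N ℕ.+ (i / N) ℕ.* N) ≡⟨ cong (λ t → ω ^ (i % N ℕ.+ t)) (ℕₚ.*-comm (i / N) N) ⟩
    ω ^ (i % N ℕ.+ N ℕ.* (i / N)) ≡⟨ ω^-periodic (i % N) (i / N) ⟩
    ω ^ (i % N)                   ∎
    where open ≡-Reasoning

  ω^i≢ω^j : ∀ {i j} → i < j → j < N → ¬ (ω ^ i ≡ ω ^ j)
  ω^i≢ω^j {i} {j} i<j j<N ω^i≡ω^j =
    proj₂ (proj₂ (order ω≢0)) (j ∸ i) (ℕₚ.m<n⇒0<n∸m i<j) (ℕₚ.≤-<-trans (ℕₚ.m∸n≤m j i) j<N)
          (x^i≡x^j⇒x^[j∸i]≡1 ω≢0 (ℕₚ.<⇒≤ i<j) ω^i≡ω^j)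

  ω^-injective : ∀ {i j} → i < N → j < N → ω ^ i ≡ ω ^ j → i ≡ j
  ω^-injective {i} {j} i<N j<N ω^i≡ω^j with ℕₚ.<-cmp i j
  ... | tri< i<j _ _ = ⊥-elim (ω^i≢ω^j i<j j<N ω^i≡ω^j)
  ... | tri≈ _ i≡j _ = i≡j
  ... | tri> _ _ j<i = ⊥-elim (ω^i≢ω^j j<i i<N (sym ω^i≡ω^j))

  C : ℕ
  C = suc (proj₁ characteristic)

  gen-periodic : ∀ i → gen i ≡ gen (i % N)
  gen-periodic i = begin
    ω ^ (k ℕ.* i)                                   ≡⟨ cong (λ j → ω ^ (k ℕ.* j)) (m≡m%n+[m/n]*n i N) ⟩
    ω ^ (k ℕ.* (i % N ℕ.+ (i / N) ℕ.* N))           ≡⟨ cong (ω ^_) (rearrange k (i % N) (i / N)) ⟩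
    ω ^ (k ℕ.* (i % N) ℕ.+ N ℕ.* (k ℕ.* (i / N)))   ≡⟨ ω^-periodic (k ℕ.* (i % N)) (k ℕ.* (i / N)) ⟩
    ω ^ (k ℕ.* (i % N))                             ∎
    where
    open ≡-Reasoning
    rearrange : ∀ k r t → k ℕ.* (r ℕ.+ t ℕ.* N) ≡ k ℕ.* r ℕ.+ N ℕ.* (k ℕ.* t)
    rearrange k r t =
      solve 4 (λ k r t n → k :* (r :+ t :* (con 1 :+ n)) := k :* r :+ (con 1 :+ n) :* (k :* t)) refl k r t N₁
      where open +-*-Solver

  -- A walk only ever adds some gen (i % N), so K consists of the combinations of gen 0, …, gen (N - 1)
  -- with coefficients below the characteristic; this finite search decides K.
  Span : ℕ → V → Set
  Span zero x = x ≡ 0#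
  Span (suc t) x = Σ (Fin C) λ c → Span t (x - (toℕ c · gen t))

  span? : ∀ t → Decidable (Span t)
  span? zero x = x ≟ 0#
  span? (suc t) x = any? (λ c → span? t (x - (toℕ c · gen t)))

  Span⇒K : ∀ t {x} → Span t x → K x
  Span⇒K zero x≡0 = subst K (sym x≡0) ε
  Span⇒K (suc t) {x} (c , rest) =
    subst K (trans (+-comm _ (toℕ c · gen t)) (x+[y-x]≡y (toℕ c · gen t) x))
            (K-+ (Span⇒K t rest) (K-· (toℕ c) (K-gen t)))

  Span-0 : ∀ t → Span t 0#
  Span-0 zero = refl
  Span-0 (suc t) = Fin.zero , subst (Span t) (sym (-‿inverseʳ 0#)) (Span-0 t)

  Span-+gen : ∀ t j → j < t → ∀ {x} → Span t x → Span t (x + gen j)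
  Span-+gen (suc t) j j<1+t {x} (c , rest) with ℕₚ.m<1+n⇒m<n∨m≡n j<1+t
  ... | inj₁ j<t = c , subst (Span t) (shuffle x (toℕ c · gen t) (gen j)) (Span-+gen t j j<t rest)
    where
    shuffle : ∀ a b c → (a - b) + c ≡ (a + c) - b
    shuffle a b c = trans (+-assoc a (- b) c) (trans (cong (a +_) (+-comm (- b) c)) (sym (+-assoc a c (- b))))
  ... | inj₂ refl with suc (toℕ c) ℕ.<? C
  ...   | yes 1+c<C = Fin.fromℕ< 1+c<C , subst (Span t) carry rest
    where
    carry : x - (toℕ c · gen j) ≡ (x + gen j) - (toℕ (Fin.fromℕ< 1+c<C) · gen j)
    carry = trans (sym ([x+y]-[x+z]≡y-z (gen j) x (toℕ c · gen j)))
                  (cong₂ _-_ (+-comm (gen j) x) (cong (_· gen j) (sym (toℕ-fromℕ< 1+c<C))))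
  ...   | no 1+c≮C = Fin.zero , subst (Span t) wrap rest
    where
    c·gen≡-gen : toℕ c · gen j ≡ - gen j
    c·gen≡-gen = inverseʳ-unique (gen j) _ (trans (cong (_· gen j) 1+c≡C) ([1+c]·x≡0 (gen j)))
      where
      1+c≡C : suc (toℕ c) ≡ C
      1+c≡C = ℕₚ.≤-antisym (toℕ<n c) (ℕₚ.≮⇒≥ 1+c≮C)
    wrap : x - (toℕ c · gen j) ≡ (x + gen j) - (0 · gen j)
    wrap = begin
      x - (toℕ c · gen j)        ≡⟨ cong (λ y → x - y) c·gen≡-gen ⟩
      x - (- gen j)              ≡⟨ cong (x +_) (-‿involutive (gen j)) ⟩
      x + gen j                  ≡⟨ sym (x-0≡x (x + gen j)) ⟩
      (x + gen j) - (0 · gen j)  ∎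
      where open ≡-Reasoning

  reachable-Span : ∀ {u v} → Reachable Γ u v → Span N u → Span N v
  reachable-Span ε span = span
  reachable-Span {u} (_◅_ {j = w} (i , w-u≡gen) r) span =
    reachable-Span r (subst (Span N) step (Span-+gen N (i % N) (m%n<n i N) span))
    where
    step : u + gen (i % N) ≡ w
    step = trans (cong (u +_) (trans (sym (gen-periodic i)) (sym w-u≡gen))) (x+[y-x]≡y u w)

  opaque
    K? : Decidable K
    K? x = map′ (Span⇒K N) (λ r → reachable-Span r (Span-0 N)) (span? N x)

  opaque
    exponent : ∃ λ e₁ → K (ω ^ suc e₁) × (∀ j → 0 < j → j < suc e₁ → ¬ K (ω ^ j))
    exponent with least-ℕ (λ i → (0 ℕ.<? i) ×-dec K? (ω ^ i)) N (z<s , subst K (sym ω^N≡1) K-1)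
    ... | zero , (() , _) , _
    ... | suc e₁ , (_ , K-ω^e) , below = e₁ , K-ω^e , λ j 0<j j<e K-ω^j → below j j<e (0<j , K-ω^j)

  -- ω^e generates the multiplicative group of K
  e : ℕ
  e = suc (proj₁ exponent)

  K-ω^e : K (ω ^ e)
  K-ω^e = proj₁ (proj₂ exponent)

  e∣i⇒K-ω^i : ∀ {i} → e ∣ i → K (ω ^ i)
  e∣i⇒K-ω^i {i} (divides t i≡t*e) =
    subst K (sym (trans (cong (ω ^_) (trans i≡t*e (ℕₚ.*-comm t e))) (^-* ω e t))) (K-^ t K-ω^e)

  -- ω^(i % e) = ω^i (ω^e)^((i / e) N₁) lies in K, which the minimality of e forbids unless i % e = 0.
  K-ω^i⇒e∣i : ∀ {i} → K (ω ^ i) → e ∣ i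
  K-ω^i⇒e∣i {i} K-ω^i with i % e in r≡
  ... | zero = m%n≡0⇒n∣m i e r≡
  ... | suc r₁ = ⊥-elim (proj₂ (proj₂ exponent) (suc r₁) z<s (subst (_< e) r≡ (m%n<n i e)) K-ω^r)
    where
    r t : ℕ
    r = suc r₁
    t = i / e
    rearrange : i ℕ.+ e ℕ.* (t ℕ.* N₁) ≡ r ℕ.+ N ℕ.* (t ℕ.* e)
    rearrange = begin
      i ℕ.+ e ℕ.* (t ℕ.* N₁)                 ≡⟨ cong (ℕ._+ e ℕ.* (t ℕ.* N₁)) (m≡m%n+[m/n]*n i e) ⟩
      i % e ℕ.+ t ℕ.* e ℕ.+ e ℕ.* (t ℕ.* N₁) ≡⟨ cong (λ x → x ℕ.+ t ℕ.* e ℕ.+ e ℕ.* (t ℕ.* N₁)) r≡ ⟩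
      r ℕ.+ t ℕ.* e ℕ.+ e ℕ.* (t ℕ.* N₁)     ≡⟨ solve 4 (λ r t e n → r :+ t :* e :+ e :* (t :* n)
                                                                 := r :+ (con 1 :+ n) :* (t :* e))
                                                        refl r t e N₁ ⟩
      r ℕ.+ N ℕ.* (t ℕ.* e)                  ∎
      where open ≡-Reasoning
            open +-*-Solver
    K-ω^r : K (ω ^ r)
    K-ω^r = subst K (begin
      ω ^ i * (ω ^ e) ^ (t ℕ.* N₁)      ≡⟨ cong (ω ^ i *_) (sym (^-* ω e (t ℕ.* N₁))) ⟩
      ω ^ i * ω ^ (e ℕ.* (t ℕ.* N₁))    ≡⟨ sym (^-+ ω i _) ⟩
      ω ^ (i ℕ.+ e ℕ.* (t ℕ.* N₁))      ≡⟨ cong (ω ^_) rearrange ⟩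
      ω ^ (r ℕ.+ N ℕ.* (t ℕ.* e))       ≡⟨ ω^-periodic r (t ℕ.* e) ⟩
      ω ^ r                             ∎) (K-* K-ω^i (K-^ (t ℕ.* N₁) K-ω^e))
      where open ≡-Reasoning

  e∣N : e ∣ N
  e∣N = K-ω^i⇒e∣i (subst K (sym ω^N≡1) K-1)

  e∣k : e ∣ k
  e∣k = K-ω^i⇒e∣i (subst (λ i → K (ω ^ i)) (ℕₚ.*-identityʳ k) (K-gen 1))

  M : ℕ
  M = _∣_.quotient e∣N

  N≡M*e : N ≡ M ℕ.* e
  N≡M*e = _∣_.equality e∣N

  k′ : ℕ
  k′ = _∣_.quotient e∣k

  k≡k′*e : k ≡ k′ ℕ.* e
  k≡k′*e = _∣_.equality e∣k

  M∣N : M ∣ N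
  M∣N = divides e (trans N≡M*e (ℕₚ.*-comm M e))

  1≤M : 1 ≤ M
  1≤M = ℕₚ.n≢0⇒n>0 λ M≡0 → ℕₚ.1+n≢0 (trans N≡M*e (cong (ℕ._* e) M≡0))

  N≡k*m⇒M≡k′*m : ∀ {m} → N ≡ k ℕ.* m → M ≡ k′ ℕ.* m
  N≡k*m⇒M≡k′*m {m} N≡k*m = ℕₚ.*-cancelʳ-≡ M (k′ ℕ.* m) e (begin
    M ℕ.* e          ≡⟨ sym N≡M*e ⟩
    N                ≡⟨ N≡k*m ⟩
    k ℕ.* m          ≡⟨ cong (ℕ._* m) k≡k′*e ⟩
    k′ ℕ.* e ℕ.* m   ≡⟨ ℕₚ.*-assoc k′ e m ⟩
    k′ ℕ.* (e ℕ.* m) ≡⟨ cong (k′ ℕ.*_) (ℕₚ.*-comm e m) ⟩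
    k′ ℕ.* (m ℕ.* e) ≡⟨ sym (ℕₚ.*-assoc k′ m e) ⟩
    k′ ℕ.* m ℕ.* e   ∎)
    where open ≡-Reasoning

  log : ∀ x → ¬ (x ≡ 0#) → ∃ λ i → i < N × x ≡ ω ^ i
  log x x≢0 with ω-primitive x x≢0
  ... | i , x≡ω^i = i % N , m%n<n i N , trans x≡ω^i (ω^i≡ω^[i%N] i)

  module PowerSubset (b : V → Bool) (b-0 : T (b 0#)) (d m : ℕ) .{{_ : ℕ.NonZero d}}
                     (N≡m*d : N ≡ m ℕ.* d) (b-ω^ : ∀ i → T (b (ω ^ i)) ⇔ d ∣ i) where

    d*j<N : ∀ (j : Fin m) → d ℕ.* toℕ j < N
    d*j<N j = subst (d ℕ.* toℕ j <_) (trans (ℕₚ.*-comm d m) (sym N≡m*d)) (ℕₚ.*-monoʳ-< d (toℕ<n j))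

    index : ∀ x → ¬ (x ≡ 0#) → T (b x) → Σ (Fin m) λ j → ω ^ (d ℕ.* toℕ j) ≡ x
    index x x≢0 bx with log x x≢0
    ... | i , i<N , x≡ω^i with Equivalence.to (b-ω^ i) (subst (T ∘ b) x≡ω^i bx)
    ...   | divides c i≡c*d = Fin.fromℕ< c<m , (begin
      ω ^ (d ℕ.* toℕ (Fin.fromℕ< c<m)) ≡⟨ cong (λ j → ω ^ (d ℕ.* j)) (toℕ-fromℕ< c<m) ⟩
      ω ^ (d ℕ.* c)                    ≡⟨ cong (ω ^_) (trans (ℕₚ.*-comm d c) (sym i≡c*d)) ⟩
      ω ^ i                            ≡⟨ sym x≡ω^i ⟩
      x                                ∎)
      where
      open ≡-Reasoning
      c<m : c < m
      c<m = ℕₚ.*-cancelʳ-< d c m (subst₂ _<_ i≡c*d N≡m*d i<N)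

    index-unique : ∀ (j j′ : Fin m) → ω ^ (d ℕ.* toℕ j) ≡ ω ^ (d ℕ.* toℕ j′) → j ≡ j′
    index-unique j j′ eq = toℕ-injective (ℕₚ.*-cancelˡ-≡ _ _ d (ω^-injective (d*j<N j) (d*j<N j′) eq))

    enumeration : Fin (suc m) ↔ Filtered b
    enumeration = mk↔ₛ′ to from to∘from from∘to
      where
      to : Fin (suc m) → Filtered b
      to Fin.zero = 0# , b-0
      to (Fin.suc j) = ω ^ (d ℕ.* toℕ j) ,
                       Equivalence.from (b-ω^ _) (divides (toℕ j) (ℕₚ.*-comm d (toℕ j)))
      from′ : ∀ x → T (b x) → Dec (x ≡ 0#) → Fin (suc m)
      from′ x bx (yes _) = Fin.zero
      from′ x bx (no x≢0) = Fin.suc (proj₁ (index x x≢0 bx))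
      from : Filtered b → Fin (suc m)
      from (x , bx) = from′ x bx (x ≟ 0#)
      to∘from : ∀ y → to (from y) ≡ y
      to∘from (x , bx) with x ≟ 0#
      ... | yes x≡0 = Filtered-≡ (sym x≡0)
      ... | no x≢0 = Filtered-≡ (proj₂ (index x x≢0 bx))
      from∘to : ∀ j → from (to j) ≡ j
      from∘to Fin.zero with 0# ≟ 0#
      ... | yes _ = refl
      ... | no 0≢0 = ⊥-elim (0≢0 refl)
      from∘to (Fin.suc j) with ω ^ (d ℕ.* toℕ j) ≟ 0#
      ... | yes ω^dj≡0 = ⊥-elim (x^n≢0 (d ℕ.* toℕ j) ω≢0 ω^dj≡0)
      ... | no ω^dj≢0 = cong Fin.suc (index-unique _ j (proj₂ (index _ ω^dj≢0 _)))

  q≡1+N : q ≡ suc N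
  q≡1+N = sym (Fin-↔⇒≡ (↔-sym enum ↔-∘ (forget ↔-∘ enumeration)))
    where
    open PowerSubset (λ _ → true) _ 1 N (sym (ℕₚ.*-identityʳ N)) (λ i → mk⇔ (λ _ → 1∣ i) _)
    forget : Filtered {V} (λ _ → true) ↔ V
    forget = mk↔ₛ′ proj₁ (_, _) (λ _ → refl) (λ _ → refl)

  isK : V → Bool
  isK x = ⌊ K? x ⌋

  -- K as a subtype through its Boolean decision, so that membership is proof-irrelevant
  Kᶠ : Set
  Kᶠ = Filtered isK

  K⇒isK : ∀ {x} → K x → T (isK x)
  K⇒isK {x} = fromWitness {a? = K? x}

  isK⇒K : ∀ {x} → T (isK x) → K x
  isK⇒K {x} = toWitness {a? = K? x}

  open PowerSubset isK (K⇒isK ε) e M N≡M*e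
                    (λ i → mk⇔ (K-ω^i⇒e∣i ∘ isK⇒K) (K⇒isK ∘ e∣i⇒K-ω^i))
    using () renaming (enumeration to K-enumeration; index to K-index)

  infixl 6 _+ᴷ_
  infixl 7 _*ᴷ_
  _+ᴷ_ _*ᴷ_ : Kᶠ → Kᶠ → Kᶠ
  (x , Kx) +ᴷ (y , Ky) = x + y , K⇒isK (K-+ (isK⇒K Kx) (isK⇒K Ky))
  (x , Kx) *ᴷ (y , Ky) = x * y , K⇒isK (K-* (isK⇒K Kx) (isK⇒K Ky))

  -ᴷ_ : Kᶠ → Kᶠ
  -ᴷ (x , Kx) = - x , K⇒isK (K-neg (isK⇒K Kx))

  0ᴷ 1ᴷ : Kᶠ
  0ᴷ = 0# , K⇒isK ε
  1ᴷ = 1# , K⇒isK K-1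

  proj₁-isRingMonomorphism : IsRingMonomorphism
    (record { Carrier = Kᶠ ; _≈_ = _≡_ ; _+_ = _+ᴷ_ ; _*_ = _*ᴷ_ ; -_ = -ᴷ_ ; 0# = 0ᴷ ; 1# = 1ᴷ })
    (record { Carrier = V ; _≈_ = _≡_ ; _+_ = _+_ ; _*_ = _*_ ; -_ = -_ ; 0# = 0# ; 1# = 1# })
    proj₁
  proj₁-isRingMonomorphism = record
    { isRingHomomorphism = record
      { isSemiringHomomorphism = record
        { isNearSemiringHomomorphism = record
          { +-isMonoidHomomorphism = record
            { isMagmaHomomorphism = record
              { isRelHomomorphism = record { cong = cong proj₁ } ; homo = λ _ _ → refl }
            ; ε-homo = refl }
          ; *-homo = λ _ _ → refl }
        ; 1#-homo = refl }
      ; -‿homo = λ _ → refl }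
    ; injective = Filtered-≡ }

  x^N≡1 : ∀ {x} → ¬ (x ≡ 0#) → x ^ N ≡ 1#
  x^N≡1 {x} x≢0 with log x x≢0
  ... | i , _ , x≡ω^i = begin
    x ^ N          ≡⟨ cong (_^ N) x≡ω^i ⟩
    (ω ^ i) ^ N    ≡⟨ sym (^-* ω i N) ⟩
    ω ^ (i ℕ.* N)  ≡⟨ cong (ω ^_) (ℕₚ.*-comm i N) ⟩
    ω ^ (N ℕ.* i)  ≡⟨ cong (ω ^_) (sym (ℕₚ.+-identityˡ (N ℕ.* i))) ⟩
    ω ^ (0 ℕ.+ N ℕ.* i) ≡⟨ ω^-periodic 0 i ⟩
    1#             ∎
    where open ≡-Reasoning

  inverseᴷ : ∀ x → ¬ (x ≡ 0ᴷ) → ∃ λ y → x *ᴷ y ≡ 1ᴷ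
  inverseᴷ (x , Kx) x≢0 =
    (x ^ N₁ , K⇒isK (K-^ N₁ (isK⇒K Kx))) , Filtered-≡ (x^N≡1 (x≢0 ∘ Filtered-≡))

  subfield : ∀ {s} → suc M ≡ s → FiniteField s
  subfield {s} 1+M≡s = record
    { Carrier = Kᶠ
    ; _+_ = _+ᴷ_ ; _*_ = _*ᴷ_ ; -_ = -ᴷ_ ; 0# = 0ᴷ ; 1# = 1ᴷ
    ; isCommutativeRing = RingMonomorphism.isCommutativeRing proj₁-isRingMonomorphism isCommutativeRing
    ; 0≢1 = 0≢1 ∘ cong proj₁
    ; inverse = inverseᴷ
    ; enum = K-enumeration ↔-∘ subst (λ t → Fin s ↔ Fin t) (sym 1+M≡s) (↔-id (Fin s)) }

  ω₀ : Kᶠ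
  ω₀ = ω ^ e , K⇒isK K-ω^e

  proj₁-^ : ∀ {s} (1+M≡s : suc M ≡ s) a n →
            proj₁ (FiniteField._^_ (subfield 1+M≡s) a n) ≡ proj₁ a ^ n
  proj₁-^ 1+M≡s a zero = refl
  proj₁-^ 1+M≡s a (suc n) = cong (proj₁ a *_) (proj₁-^ 1+M≡s a n)

  ω₀-primitive : ∀ {s} (1+M≡s : suc M ≡ s) → IsPrimitive (subfield 1+M≡s) ω₀
  ω₀-primitive 1+M≡s (x , Kx) x≢0 with K-index x (x≢0 ∘ Filtered-≡) Kx
  ... | j , ω^ej≡x = toℕ j , Filtered-≡ (begin
    x                    ≡⟨ sym ω^ej≡x ⟩
    ω ^ (e ℕ.* toℕ j)    ≡⟨ ^-* ω e (toℕ j) ⟩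
    (ω ^ e) ^ toℕ j      ≡⟨ sym (proj₁-^ 1+M≡s ω₀ (toℕ j)) ⟩
    proj₁ (FiniteField._^_ (subfield 1+M≡s) ω₀ (toℕ j)) ∎)
    where open ≡-Reasoning

  K-sym : ∀ {z w} → K (w - z) → K (z - w)
  K-sym {z} {w} Kw-z = subst K (-[x-y]≡y-x w z) (K-neg Kw-z)

  K-trans : ∀ {x y z} → K (y - x) → K (z - y) → K (z - x)
  K-trans {x} {y} {z} Ky-x Kz-y = subst K ([y-x]+[z-y]≡z-x x y z) (K-+ Ky-x Kz-y)

  opaque
    least-representative : ∀ z → ∃ λ i → K (Inverse.to enum i - z) ×
                                         (∀ j → K (Inverse.to enum j - z) → toℕ i ≤ toℕ j)
    least-representative z = least-Fin (λ i → K? (Inverse.to enum i - z))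
      (Inverse.from enum z ,
       subst K (sym (trans (cong (_- z) (Inverse.strictlyInverseˡ enum z)) (-‿inverseʳ z))) ε)

  representative : V → Fin q
  representative z = proj₁ (least-representative z)

  K-representative : ∀ z → K (Inverse.to enum (representative z) - z)
  K-representative z = proj₁ (proj₂ (least-representative z))

  representative-cong : ∀ {z w} → K (w - z) → representative w ≡ representative z
  representative-cong {z} {w} Kw-z = toℕ-injective (ℕₚ.≤-antisym
    (proj₂ (proj₂ (least-representative w)) _ (K-trans (K-sym Kw-z) (K-representative z)))
    (proj₂ (proj₂ (least-representative z)) _ (K-trans Kw-z (K-representative w))))

  isRepresentative : Fin q → Bool
  isRepresentative i = ⌊ representative (Inverse.to enum i) Fin.≟ i ⌋

  Representatives : Set
  Representatives = Filtered isRepresentative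

  coset : V → Representatives
  coset z = representative z , fromWitness (representative-cong (K-representative z))

  coset-cong : ∀ {z w} → K (w - z) → coset w ≡ coset z
  coset-cong Kw-z = Filtered-≡ (representative-cong Kw-z)

  coset-decomposition : (Representatives × Kᶠ) ↔ V
  coset-decomposition = mk↔ₛ′ to from to∘from from∘to
    where
    to : Representatives × Kᶠ → V
    to ((i , _) , (x , _)) = Inverse.to enum i + x
    from : V → Representatives × Kᶠ
    from z = coset z , (z - Inverse.to enum (representative z)) , K⇒isK (K-sym (K-representative z))
    to∘from : ∀ z → to (from z) ≡ z
    to∘from z = x+[y-x]≡y (Inverse.to enum (representative z)) z
    from∘to : ∀ y → from (to y) ≡ y
    from∘to ((i , i-rep) , (x , Kx)) = cong₂ _,_ (Filtered-≡ rep≡i) (Filtered-≡ (begin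
      (c + x) - Inverse.to enum (representative (c + x))
        ≡⟨ cong (λ j → (c + x) - Inverse.to enum j) rep≡i ⟩
      (c + x) - c                                        ≡⟨ [x+y]-x≡y c x ⟩
      x                                                  ∎))
      where
      open ≡-Reasoning
      c : V
      c = Inverse.to enum i
      rep≡i : representative (c + x) ≡ i
      rep≡i = trans (representative-cong (subst K (sym ([x+y]-x≡y c x)) (isK⇒K Kx))) (toWitness i-rep)

  opaque
    coset-enumeration : Σ ℕ λ r → Fin r ↔ Representatives
    coset-enumeration = filter-enumeration q isRepresentative

  r : ℕ
  r = proj₁ coset-enumeration

  coset-count : r ℕ.* suc M ≡ q
  coset-count = Fin-↔⇒≡
    (↔-sym enum ↔-∘ (coset-decomposition ↔-∘ ((proj₂ coset-enumeration ×-↔ K-enumeration) ↔-∘ *↔×)))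

  one-coset⇒connected : r ≡ 1 → Connected Γ
  one-coset⇒connected r≡1 u v = K⇒reachable (K-trans (K-representative u)
    (subst (λ j → K (v - Inverse.to enum j)) rep-v≡rep-u (K-sym (K-representative v))))
    where
    Fin1-irrelevant : ∀ {m} → m ≡ 1 → (i j : Fin m) → i ≡ j
    Fin1-irrelevant refl Fin.zero Fin.zero = refl
    rep-v≡rep-u : representative v ≡ representative u
    rep-v≡rep-u = cong proj₁ (↔-injective (↔-sym (proj₂ coset-enumeration)) {coset v} {coset u}
                                (Fin1-irrelevant r≡1 _ _))

  module Structure {s n : ℕ} (1+M≡s : suc M ≡ s) (r≡n : r ≡ n) where

    F₀ : FiniteField s
    F₀ = subfield 1+M≡s

    Γ₀ : Graph
    Γ₀ = GPaley F₀ ω₀ k′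

    ω₀^[k′i]≡gen : ∀ i → proj₁ (FiniteField._^_ F₀ ω₀ (k′ ℕ.* i)) ≡ gen i
    ω₀^[k′i]≡gen i = begin
      proj₁ (FiniteField._^_ F₀ ω₀ (k′ ℕ.* i)) ≡⟨ proj₁-^ 1+M≡s ω₀ (k′ ℕ.* i) ⟩
      (ω ^ e) ^ (k′ ℕ.* i)                      ≡⟨ sym (^-* ω e (k′ ℕ.* i)) ⟩
      ω ^ (e ℕ.* (k′ ℕ.* i))                    ≡⟨ cong (ω ^_) (sym (ℕₚ.*-assoc e k′ i)) ⟩
      ω ^ (e ℕ.* k′ ℕ.* i)                      ≡⟨ cong (λ t → ω ^ (t ℕ.* i)) (ℕₚ.*-comm e k′) ⟩
      ω ^ (k′ ℕ.* e ℕ.* i)                      ≡⟨ cong (λ t → ω ^ (t ℕ.* i)) (sym k≡k′*e) ⟩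
      gen i                                     ∎
      where open ≡-Reasoning

    translated-adjacency : ∀ v (x y : Kᶠ) → Adj Γ₀ x y ⇔ Adj Γ (v + proj₁ x) (v + proj₁ y)
    translated-adjacency v x y = mk⇔
      (λ { (i , y-x≡) → i , trans difference (trans (cong proj₁ y-x≡) (ω₀^[k′i]≡gen i)) })
      (λ { (i , y-x≡) → i , Filtered-≡ (trans (sym difference) (trans y-x≡ (sym (ω₀^[k′i]≡gen i)))) })
      where
      difference : (v + proj₁ y) - (v + proj₁ x) ≡ proj₁ y - proj₁ x
      difference = [x+y]-[x+z]≡y-z v (proj₁ y) (proj₁ x)

    component-isomorphism : ∀ v → ∃ λ f → IsoOntoComponent Γ₀ Γ v f
    component-isomorphism v = (λ x → v + proj₁ x)
                            , (λ x y v+x≡v+y → Filtered-≡ (+-cancelˡ v _ _ v+x≡v+y))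
                            , translated-adjacency v
                            , λ u → mk⇔ (λ v⇝u → ((u - v) , K⇒isK (reachable⇒K v⇝u)) , x+[y-x]≡y v u)
                                        (λ { ((x , Kx) , v+x≡u) → K⇒reachable (subst K (u-v≡ v+x≡u) (isK⇒K Kx)) })
      where
      u-v≡ : ∀ {x u} → v + x ≡ u → x ≡ u - v
      u-v≡ {x} v+x≡u = trans (sym ([x+y]-x≡y v x)) (cong (_- v) v+x≡u)

    labelled-cosets : Fin n ↔ Representatives
    labelled-cosets = proj₂ coset-enumeration ↔-∘ subst (λ t → Fin n ↔ Fin t) (sym r≡n) (↔-id (Fin n))

    φ : (Fin n × Kᶠ) ↔ V
    φ = coset-decomposition ↔-∘ (labelled-cosets ×-↔ ↔-id Kᶠ)

    labelling : IsComponentLabelling Γ₀ Γ n φ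
    labelling = (λ j → translated-adjacency (c j))
              , (λ j x y → K⇒reachable (subst K (sym ([x+y]-[x+z]≡y-z (c j) (proj₁ y) (proj₁ x)))
                                           (K-- (isK⇒K (proj₂ y)) (isK⇒K (proj₂ x)))))
              , λ j j′ x y φjx⇝φj′y → begin
                  j                                      ≡⟨ sym (cong proj₁ (Inverse.strictlyInverseʳ φ (j , x))) ⟩
                  label (coset (c j + proj₁ x))          ≡⟨ cong label (sym (coset-cong (reachable⇒K φjx⇝φj′y))) ⟩
                  label (coset (c j′ + proj₁ y))         ≡⟨ cong proj₁ (Inverse.strictlyInverseʳ φ (j′ , y)) ⟩
                  j′                                     ∎
      where
      open ≡-Reasoning
      c : Fin n → V
      c j = Inverse.to enum (proj₁ (Inverse.to labelled-cosets j))
      label : Representatives → Fin n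
      label = Inverse.from labelled-cosets

    automorphism-is-wreath : AutIsWreath Γ₀ Γ n φ
    automorphism-is-wreath = ComponentLabelling.automorphism-is-wreath φ labelling 0ᴷ

-- Prime powers

open import Data.Nat using (_+_; _*_; _∸_; _^_)
open import Data.Nat.Properties
open import Data.Nat.Divisibility
open import Data.Nat.Primality using (Prime; prime⇒irreducible; prime⇒nonZero; prime⇒nonTrivial)
open import Data.Nat.Coprimality using (Coprime; coprime-divisor)

prime⇒1< : ∀ {p} → Prime p → 1 < p
prime⇒1< {p} p-prime = ℕ.nonTrivial⇒n>1 p {{prime⇒nonTrivial p-prime}}

∣p^n⇒≡p^a : ∀ {p} → Prime p → ∀ n {d} → d ∣ p ^ n → ∃ λ a → d ≡ p ^ a
∣p^n⇒≡p^a p-prime zero d∣1 = 0 , ∣1⇒≡1 d∣1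
∣p^n⇒≡p^a {p} p-prime (suc n) {d} d∣p^[1+n] with p ∣? d
... | yes (divides c refl) with ∣p^n⇒≡p^a p-prime n c∣p^n
  where
  c∣p^n : c ∣ p ^ n
  c∣p^n = *-cancelʳ-∣ p {{prime⇒nonZero p-prime}} (subst (c * p ∣_) (*-comm p (p ^ n)) d∣p^[1+n])
...   | a , refl = suc a , *-comm (p ^ a) p
∣p^n⇒≡p^a {p} p-prime (suc n) {d} d∣p^[1+n] | no p∤d =
  ∣p^n⇒≡p^a p-prime n (coprime-divisor coprime d∣p^[1+n])
  where
  coprime : Coprime d p
  coprime (e∣d , e∣p) with prime⇒irreducible p-prime e∣p
  ... | inj₁ e≡1 = e≡1
  ... | inj₂ refl = ⊥-elim (p∤d e∣d)

∣∧<⇒≡0 : ∀ {d x} → d ∣ x → x < d → x ≡ 0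
∣∧<⇒≡0 {x = zero} _ _ = refl
∣∧<⇒≡0 {x = suc x} d∣x x<d = ⊥-elim (<⇒≱ x<d (∣⇒≤ d∣x))

module _ {p : ℕ} (1<p : 1 < p) where

  private
    instance
      p≢0 : ℕ.NonZero p
      p≢0 = ℕ.>-nonZero (<-trans ℕ.z<s 1<p)

  p^a∣p^n⇒a≤n : ∀ {a n} → p ^ a ∣ p ^ n → a ≤ n
  p^a∣p^n⇒a≤n {a} {n} p^a∣p^n with a ℕ.≤? n
  ... | yes a≤n = a≤n
  ... | no a≰n = ⊥-elim (<⇒≱ (^-monoʳ-< p 1<p (≰⇒> a≰n)) (∣⇒≤ {{m^n≢0 p n}} p^a∣p^n))

  m*p^a≡p^n⇒m≡p^[n∸a] : ∀ {m a n} → a ≤ n → m * p ^ a ≡ p ^ n → m ≡ p ^ (n ∸ a)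
  m*p^a≡p^n⇒m≡p^[n∸a] {m} {a} {n} a≤n eq = *-cancelʳ-≡ m (p ^ (n ∸ a)) (p ^ a) {{m^n≢0 p a}} (begin
    m * p ^ a           ≡⟨ eq ⟩
    p ^ n               ≡⟨ cong (p ^_) (sym (m∸n+n≡m a≤n)) ⟩
    p ^ (n ∸ a + a)     ≡⟨ ^-distribˡ-+-* p (n ∸ a) a ⟩
    p ^ (n ∸ a) * p ^ a ∎)
    where open ≡-Reasoning

  p^[b+a]∸1≡p^b*[p^a∸1]+[p^b∸1] : ∀ b a → p ^ (b + a) ∸ 1 ≡ p ^ b * (p ^ a ∸ 1) + (p ^ b ∸ 1)
  p^[b+a]∸1≡p^b*[p^a∸1]+[p^b∸1] b a =
    trans (cong (_∸ 1) (^-distribˡ-+-* p b a)) (expand (p ^ b) (p ^ a) (m^n>0 p b) (m^n>0 p a))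
    where
    expand : ∀ x y → 1 ≤ x → 1 ≤ y → x * y ∸ 1 ≡ x * (y ∸ 1) + (x ∸ 1)
    expand (suc x) (suc y) _ _ = solve 2 (λ x y → y :+ x :* (con 1 :+ y) := (y :+ x :* y) :+ x) refl x y
      where open +-*-Solver

  -- Euclid on exponents: p^a ∸ 1 ∣ p^n ∸ 1 gives p^a ∸ 1 ∣ p^(n ∸ a) ∸ 1.
  p^a∸1∣p^n∸1⇒a∣n : ∀ {a} → 1 ≤ a → ∀ n → (p ^ a ∸ 1) ∣ (p ^ n ∸ 1) → a ∣ n
  p^a∸1∣p^n∸1⇒a∣n {a} 1≤a = <-rec (λ n → (p ^ a ∸ 1) ∣ (p ^ n ∸ 1) → a ∣ n) step
    where
    step : ∀ n → (∀ {n′} → n′ < n → (p ^ a ∸ 1) ∣ (p ^ n′ ∸ 1) → a ∣ n′) →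
           (p ^ a ∸ 1) ∣ (p ^ n ∸ 1) → a ∣ n
    step n smaller d with a ℕ.≤? n
    ... | yes a≤n =
      subst (a ∣_) (m∸n+n≡m a≤n) (∣m∣n⇒∣m+n (smaller (∸-monoʳ-< 1≤a a≤n) d′) ∣-refl)
      where
      d′ : (p ^ a ∸ 1) ∣ (p ^ (n ∸ a) ∸ 1)
      d′ = ∣m+n∣m⇒∣n (subst ((p ^ a ∸ 1) ∣_) (p^[b+a]∸1≡p^b*[p^a∸1]+[p^b∸1] (n ∸ a) a)
                         (subst (λ x → (p ^ a ∸ 1) ∣ (p ^ x ∸ 1)) (sym (m∸n+n≡m a≤n)) d))
                     (n∣m*n (p ^ (n ∸ a)))
    ... | no a≰n = subst (a ∣_) (sym n≡0) (a ∣0)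
      where
      p^n∸1<p^a∸1 : p ^ n ∸ 1 < p ^ a ∸ 1
      p^n∸1<p^a∸1 = ∸-monoˡ-< (^-monoʳ-< p 1<p (≰⇒> a≰n)) (m^n>0 p n)
      p^n≡1 : p ^ n ≡ 1
      p^n≡1 = ≤-antisym (m∸n≡0⇒m≤n (∣∧<⇒≡0 d p^n∸1<p^a∸1)) (m^n>0 p n)
      n≡0 : n ≡ 0
      n≡0 with m^n≡1⇒n≡0∨m≡1 p n p^n≡1
      ... | inj₁ n≡0 = n≡0
      ... | inj₂ refl = ⊥-elim (<-irrefl refl 1<p)

  1<p^n : ∀ {n} → 1 ≤ n → 1 < p ^ n
  1<p^n {n} 1≤n = <-≤-trans 1<p (subst (_≤ p ^ n) (*-identityʳ p) (^-monoʳ-≤ p 1≤n))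

factor-of-prime-power : ∀ {p} → Prime p → ∀ n {r s} → r * s ≡ p ^ n → 1 < s →
                        (s ∸ 1) ∣ (p ^ n ∸ 1) → ¬ r ≡ 1 →
                        ∃ λ a → a ∣ n × a < n × s ≡ p ^ a × r ≡ p ^ (n ∸ a)
factor-of-prime-power {p} p-prime n {r} {s} r*s≡p^n 1<s s∸1∣p^n∸1 r≢1
  with ∣p^n⇒≡p^a p-prime n (divides r (sym r*s≡p^n))
... | zero , refl = ⊥-elim (<-irrefl refl 1<s)
... | a@(suc _) , refl = a , a∣n , ≤∧≢⇒< a≤n a≢n , refl , r≡p^[n∸a]
  where
  1<p : 1 < p
  1<p = prime⇒1< p-prime
  a≤n : a ≤ n
  a≤n = p^a∣p^n⇒a≤n 1<p (divides r (sym r*s≡p^n))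
  r≡p^[n∸a] : r ≡ p ^ (n ∸ a)
  r≡p^[n∸a] = m*p^a≡p^n⇒m≡p^[n∸a] 1<p a≤n r*s≡p^n
  a∣n : a ∣ n
  a∣n = p^a∸1∣p^n∸1⇒a∣n 1<p (s≤s z≤n) n s∸1∣p^n∸1
  a≢n : ¬ a ≡ n
  a≢n refl = r≢1 (trans r≡p^[n∸a] (cong (p ^_) (n∸n≡0 a)))

q∸1≡k*m⇒3≤q : ∀ {q k m} → 1 < q → 2 ≤ k → q ∸ 1 ≡ k * m → 3 ≤ q
q∸1≡k*m⇒3≤q {suc q} {k} {zero} (s≤s 1≤q) _ q≡k*0 =
  ⊥-elim (<⇒≱ 1≤q (≤-reflexive (trans q≡k*0 (*-zeroʳ k))))
q∸1≡k*m⇒3≤q {suc q} {k} {suc m} _ 2≤k q≡k*m =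
  s≤s (subst (2 ≤_) (sym q≡k*m) (≤-trans 2≤k (m≤m*n k (suc m))))

lemma3p11 :
    (p R : ℕ) → Prime p → 1 ≤ R →
    (F : FiniteField (p ^ R)) → (ω : Carrier F) → IsPrimitive F ω →
    (k m : ℕ) → 2 ≤ k → (p ^ R) ∸ 1 ≡ k * m → (¬ (p ≡ 2) → 2 ∣ m) →
    -- (1) Γ connected iff ⟨ω̂^k⟩ acts irreducibly on V over F_p
    (Connected (GPaley F ω k) ⇔ ActsIrreducibly F p ω k)
    ×
    -- (2) the disconnected case
    (¬ Connected (GPaley F ω k) →
      Σ ℕ λ a → a ∣ R × a < R ×
      Σ ℕ λ k' →
      Σ (FiniteField (p ^ a)) λ F₀ →
      Σ (Carrier F₀) λ ω₀ →
        IsPrimitive F₀ ω₀ × k' ∣ ((p ^ a) ∸ 1) × (p ^ a) ∸ 1 ≡ k' * m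
      × (∀ v → ∃ λ f → IsoOntoComponent (GPaley F₀ ω₀ k') (GPaley F ω k) v f)
      × Σ ((Fin (p ^ (R ∸ a)) × Carrier F₀) ↔ Carrier F) λ φ →
          IsComponentLabelling (GPaley F₀ ω₀ k') (GPaley F ω k) (p ^ (R ∸ a)) φ
        × AutIsWreath (GPaley F₀ ω₀ k') (GPaley F ω k) (p ^ (R ∸ a)) φ)
lemma3p11 p R p-prime 1≤R F ω ω-primitive k m 2≤k q∸1≡k*m _ =
    Paley.connected⇔irreducible F ω k p
  , λ disconnected →
      let (a , a∣R , a<R , 1+M≡p^a , r≡p^[R∸a]) =
            factor-of-prime-power p-prime R coset-count (s≤s 1≤M) (subst (M ∣_) N≡p^R∸1 M∣N)
                                  (disconnected ∘ one-coset⇒connected)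
          p^a∸1≡k′*m : p ^ a ∸ 1 ≡ k′ * m
          p^a∸1≡k′*m = trans (cong (_∸ 1) (sym 1+M≡p^a)) (N≡k*m⇒M≡k′*m N≡k*m)
          open Structure 1+M≡p^a r≡p^[R∸a]
      in  a , a∣R , a<R , k′ , F₀ , ω₀ , ω₀-primitive 1+M≡p^a
        , divides m (trans p^a∸1≡k′*m (*-comm k′ m)) , p^a∸1≡k′*m
        , component-isomorphism , φ , labelling , automorphism-is-wreath
  where
  ω≢0 : ¬ (ω ≡ FiniteField.0# F)
  ω≢0 = primitive⇒≢0 F ω-primitive
          (q∸1≡k*m⇒3≤q (1<p^n (prime⇒1< p-prime) 1≤R) 2≤k q∸1≡k*m)
  open PrimitivePaley F ω ω-primitive ω≢0 k
  N≡p^R∸1 : N ≡ p ^ R ∸ 1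
  N≡p^R∸1 = cong (_∸ 1) (sym q≡1+N)
  N≡k*m : N ≡ k * m
  N≡k*m = trans N≡p^R∸1 q∸1≡k*m
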